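{- Let $T$ be a finite tree, let $k>0$ be an integer and let $d$ be the diameter of $T$. If $k<d<2k$, then $\gamma_{all,k}^\infty(T)=2$; and if $d\le k$, then $\gamma_{all,k}^\infty(T)=1$.
   Context: Eternal distance-$k$ domination: guards are placed on vertices of a graph $G$ (several guards may occupy the same vertex) so that the occupied vertices form a distance-$k$ dominating set (every vertex within distance $k$ of an occupied vertex). In each round an attacker chooses a vertex; every guard may move to any vertex at distance at most $k$ from its current position (or stay), after which the attacked vertex must be occupied and the occupied vertices again distance-$k$ dominating. $\gamma_{all,k}^\infty(G)$ is the minimum number of guards allowing the guards to answer every infinite sequence of attacks. -}

module Defs where

open import Level using (0ℓ)
open import Data.Nat using (ℕ; zero; suc; _≤_; _<_)
open import Data.Fin using (Fin)
open import Data.List using (List; []; _∷_; _++_; length)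
open import Data.List.Relation.Unary.Unique.Propositional using (Unique)
open import Data.Product using (Σ; ∃; _×_; _,_)
open import Relation.Binary.PropositionalEquality using (_≡_)
open import Relation.Nullary using (¬_)
open import Data.Unit using (⊤)

record Graph (n : ℕ) : Set₁ where
  field
    Adj   : Fin n → Fin n → Set
    sym   : ∀ {u v} → Adj u v → Adj v u
    irrefl : ∀ {u} → ¬ Adj u u

module _ {n : ℕ} (G : Graph n) where
  open Graph G

  data Walk : Fin n → Fin n → ℕ → Set where
    here : ∀ {u} → Walk u u 0
    step : ∀ {u w v ℓ} → Adj u w → Walk w v ℓ → Walk u v (suc ℓ)

  DistLe : Fin n → Fin n → ℕ → Set
  DistLe u v k = Σ ℕ λ ℓ → ℓ ≤ k × Walk u v ℓ

  IsDist : Fin n → Fin n → ℕ → Set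
  IsDist u v d = DistLe u v d × (∀ j → DistLe u v j → d ≤ j)

  Connected : Set
  Connected = ∀ u v → Σ ℕ λ ℓ → Walk u v ℓ

  Chain : List (Fin n) → Set
  Chain []            = ⊤
  Chain (x ∷ [])      = ⊤
  Chain (x ∷ y ∷ xs)  = Adj x y × Chain (y ∷ xs)

  HasCycle : Set
  HasCycle = Σ (Fin n) λ v → Σ (List (Fin n)) λ ws →
               2 ≤ length ws × Unique (v ∷ ws) × Chain (v ∷ ws ++ v ∷ [])

  IsTree : Set
  IsTree = 1 ≤ n × Connected × ¬ HasCycle

  IsDiameter : ℕ → Set
  IsDiameter d = (∀ u v → DistLe u v d) × (Σ (Fin n) λ u → Σ (Fin n) λ v → IsDist u v d)

  -- Eternal distance-k domination with m (labelled) guards;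
  -- several guards may share a vertex.
  Config : ℕ → Set
  Config m = Fin m → Fin n

  module _ (k : ℕ) {m : ℕ} where
    Occupied : Config m → Fin n → Set
    Occupied C v = Σ (Fin m) λ i → C i ≡ v

    Dominating : Config m → Set
    Dominating C = ∀ v → Σ (Fin m) λ i → DistLe (C i) v k

    Move : Config m → Config m → Set
    Move C C' = ∀ i → DistLe (C i) (C' i) k

  -- m guards can defend every infinite sequence of attacks: there is a
  -- nonempty family S of dominating configurations closed under responses
  -- (the defender's winning positions).
  EternalWins : ℕ → ℕ → Set₁
  EternalWins k m =
    Σ (Config m → Set) λ S →
      (Σ (Config m) S)
      × (∀ C → S C → Dominating k C)
      × (∀ C → S C → ∀ v → Σ (Config m) λ C' → S C' × Move k C C' × Occupied k C' v)

  EternalDomNum : ℕ → ℕ → Set₁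
  EternalDomNum k m = EternalWins k m × (∀ j → j < m → ¬ EternalWins k j)

-- In a forest the path between two vertices is unique, so every path is a shortest walk
-- and has length at most the diameter d. Let c be the vertex of a longest path at
-- distance ⌊ d /2⌋ from one end and ⌈ d /2⌉ from the other. Two paths leaving c through
-- different neighbours are disjoint (otherwise they would close a cycle), so a path from
-- c avoids one of the two halves and extends it to a path of length at most d; hence
-- every vertex lies within ⌈ d /2⌉ ≤ k of c. Two guards then defend forever: the guard
-- on c answers the attack and the other one moves to c, which it reaches from anywhere.
-- One guard is not enough when k < d: once drawn to one end of a diametral path it no
-- longer dominates the other end. When d ≤ k a single guard reaches every vertex at once.
module Submission where

open import Defs
open import Function using (_∘_)
open import Data.Empty using (⊥-elim)
open import Data.Unit using (⊤; tt)
open import Data.Nat using (ℕ; _≤_; _<_; _*_; zero; suc; _+_; _∸_; _⊓_; ⌊_/2⌋; ⌈_/2⌉; s≤s; z≤n)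
open import Data.Nat.Properties
  using ( ≤-refl; ≤-reflexive; ≤-trans; ≤-antisym; <⇒≤; <⇒≱; +-comm; +-identityʳ
        ; +-monoˡ-≤; +-cancelˡ-≤; m≤n⇒m≤1+n; m+n∸m≡n; m≤n⇒m⊓n≡m; module ≤-Reasoning
        ; ⌈n/2⌉-mono; ⌊n/2⌋≤n; ⌊n/2⌋≤⌈n/2⌉; ⌊n/2⌋+⌈n/2⌉≡n; n≡⌈n+n/2⌉ )
open import Data.Fin using (Fin; zero; suc; fromℕ<; _≟_)
open import Data.List using (List; []; _∷_; _++_; length; take; drop)
open import Data.List.Properties using (length-++; length-++-≤ʳ; length-take; length-drop; take++drop≡id)
open import Data.List.Membership.Propositional using (_∈_; _∉_)
open import Data.List.Membership.Propositional.Properties using (∈-++⁺ˡ; ∈-++⁺ʳ; ∈-++⁻)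
open import Data.List.Relation.Unary.Any using (here; there)
open import Data.List.Relation.Unary.All using ([])
open import Data.List.Relation.Unary.All.Properties using (¬Any⇒All¬)
open import Data.List.Relation.Unary.AllPairs using ([]; _∷_)
open import Data.List.Relation.Unary.Unique.Propositional using (Unique)
open import Data.List.Relation.Unary.Unique.Propositional.Properties
  using (++⁺; Unique[x∷xs]⇒x∉xs)
open import Data.List.Relation.Binary.Disjoint.Propositional using (Disjoint)
open import Data.List.Relation.Binary.Subset.Propositional using (_⊆_)
open import Data.List.Relation.Binary.Subset.Propositional.Properties
  using (∷⁺ʳ; xs⊆ys++xs)
open import Data.Product using (Σ; _×_; ∃-syntax; ∃₂; _,_; proj₁; proj₂)
open import Data.Sum as Sum using (_⊎_; inj₁; inj₂)
open import Relation.Nullary using (¬_; yes; no)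
open import Relation.Binary.PropositionalEquality
  using (_≡_; _≢_; refl; sym; trans; cong; subst; module ≡-Reasoning)

module _ {A : Set} where

  Unique-∷⁺ : ∀ {x : A} {xs} → x ∉ xs → Unique xs → Unique (x ∷ xs)
  Unique-∷⁺ {xs = xs} x∉xs u = ¬Any⇒All¬ xs x∉xs ∷ u

  Unique-++⁻ : ∀ xs {ys : List A} → Unique (xs ++ ys) → Unique xs × Unique ys × Disjoint xs ys
  Unique-++⁻ []       u = [] , u , λ { (() , _) }
  Unique-++⁻ (x ∷ xs) u@(_ ∷ u′) with uxs , uys , disjoint ← Unique-++⁻ xs u′ =
    Unique-∷⁺ (x∉ ∘ ∈-++⁺ˡ) uxs , uys , λ where
      (here refl , x∈ys)  → x∉ (∈-++⁺ʳ xs x∈ys)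
      (there y∈xs , y∈ys) → disjoint (y∈xs , y∈ys)
    where x∉ = Unique[x∷xs]⇒x∉xs u

m+o≤n⇒o≤⌈n/2⌉ : ∀ n {m o} → ⌊ n /2⌋ ≤ m → m + o ≤ n → o ≤ ⌈ n /2⌉
m+o≤n⇒o≤⌈n/2⌉ n {m} {o} ⌊n/2⌋≤m m+o≤n = +-cancelˡ-≤ ⌊ n /2⌋ o ⌈ n /2⌉ (begin
  ⌊ n /2⌋ + o       ≤⟨ +-monoˡ-≤ o ⌊n/2⌋≤m ⟩
  m + o             ≤⟨ m+o≤n ⟩
  n                 ≡⟨ ⌊n/2⌋+⌈n/2⌉≡n n ⟨
  ⌊ n /2⌋ + ⌈ n /2⌉ ∎)
  where open ≤-Reasoning

n≤2m⇒⌈n/2⌉≤m : ∀ {n m} → n ≤ 2 * m → ⌈ n /2⌉ ≤ m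
n≤2m⇒⌈n/2⌉≤m {n} {m} n≤2m = begin
  ⌈ n /2⌉     ≤⟨ ⌈n/2⌉-mono n≤2m ⟩
  ⌈ 2 * m /2⌉ ≡⟨ cong (λ k → ⌈ m + k /2⌉) (+-identityʳ m) ⟩
  ⌈ m + m /2⌉ ≡⟨ n≡⌈n+n/2⌉ m ⟨
  m           ∎
  where open ≤-Reasoning

module Walks {n : ℕ} (G : Graph n) where
  open Graph G using (Adj) renaming (sym to Adj-sym)
  open import Data.List.Membership.DecPropositional (_≟_ {n}) using (_∈?_)

  private variable
    a b c s t u v w x : Fin n
    ps qs vs ws : List (Fin n)
    ℓ ℓ′ : ℕ

  -- The list records the vertices visited after the start s.
  infixr 5 _∷_
  data WalkVia : Fin n → Fin n → List (Fin n) → Set where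
    []  : WalkVia s s []
    _∷_ : Adj s w → WalkVia w t vs → WalkVia s t (w ∷ vs)

  Path : Fin n → Fin n → List (Fin n) → Set
  Path s t vs = WalkVia s t vs × Unique (s ∷ vs)

  toWalk : WalkVia s t vs → Walk G s t (length vs)
  toWalk []         = here
  toWalk (e ∷ walk) = step e (toWalk walk)

  fromWalk : Walk G s t ℓ → ∃[ vs ] WalkVia s t vs × length vs ≡ ℓ
  fromWalk here = [] , [] , refl
  fromWalk (step e walk) with vs , ws , len ← fromWalk walk = _ ∷ vs , e ∷ ws , cong suc len

  toDistLe : WalkVia s t vs → length vs ≤ ℓ → DistLe G s t ℓ
  toDistLe walk len = _ , len , toWalk walk

  fromDistLe : DistLe G s t ℓ → ∃[ vs ] WalkVia s t vs × length vs ≤ ℓ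
  fromDistLe (_ , m≤ℓ , walk) with vs , ws , refl ← fromWalk walk = vs , ws , m≤ℓ

  DistLe-weaken : ℓ ≤ ℓ′ → DistLe G s t ℓ → DistLe G s t ℓ′
  DistLe-weaken ℓ≤ℓ′ (m , m≤ℓ , walk) = m , ≤-trans m≤ℓ ℓ≤ℓ′ , walk

  infixr 5 _++ʷ_
  _++ʷ_ : WalkVia s t vs → WalkVia t u ws → WalkVia s u (vs ++ ws)
  []       ++ʷ walk = walk
  (e ∷ w₁) ++ʷ w₂   = e ∷ (w₁ ++ʷ w₂)

  end∈ : WalkVia s t vs → t ∈ s ∷ vs
  end∈ []         = here refl
  end∈ (_ ∷ walk) = there (end∈ walk)

  reverseFrom : Fin n → List (Fin n) → List (Fin n)
  reverseFrom s []       = []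
  reverseFrom s (w ∷ vs) = reverseFrom w vs ++ s ∷ []

  length-reverseFrom : ∀ s vs → length (reverseFrom s vs) ≡ length vs
  length-reverseFrom s []       = refl
  length-reverseFrom s (w ∷ vs) = begin
    length (reverseFrom w vs ++ s ∷ []) ≡⟨ length-++ (reverseFrom w vs) ⟩
    length (reverseFrom w vs) + 1       ≡⟨ cong (_+ 1) (length-reverseFrom w vs) ⟩
    length vs + 1                       ≡⟨ +-comm (length vs) 1 ⟩
    suc (length vs)                     ∎
    where open ≡-Reasoning

  reverseʷ : WalkVia s t vs → WalkVia t s (reverseFrom s vs)
  reverseʷ []         = []
  reverseʷ (e ∷ walk) = reverseʷ walk ++ʷ Adj-sym e ∷ []

  ∈-reverseʷ : WalkVia s t vs → x ∈ t ∷ reverseFrom s vs → x ∈ s ∷ vs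
  ∈-reverseʷ []                                     x∈ = x∈
  ∈-reverseʷ {t = t} (_∷_ {w = w} {vs = vs} _ walk) x∈ with ∈-++⁻ (t ∷ reverseFrom w vs) x∈
  ... | inj₁ x∈′         = there (∈-reverseʷ walk x∈′)
  ... | inj₂ (here refl) = here refl

  Unique-reverseʷ : WalkVia s t vs → Unique (s ∷ vs) → Unique (t ∷ reverseFrom s vs)
  Unique-reverseʷ []         u        = u
  Unique-reverseʷ (_ ∷ walk) (s∉ ∷ u) = ++⁺ (Unique-reverseʷ walk u) ([] ∷ []) λ where
    (s∈ , here refl) → Unique[x∷xs]⇒x∉xs (s∉ ∷ u) (∈-reverseʷ walk s∈)

  reversePath : Path s t vs → Path t s (reverseFrom s vs)
  reversePath (walk , u) = reverseʷ walk , Unique-reverseʷ walk u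

  DistLe-sym : DistLe G s t ℓ → DistLe G t s ℓ
  DistLe-sym {s = s} dist with vs , walk , len ← fromDistLe dist =
    toDistLe (reverseʷ walk) (≤-trans (≤-reflexive (length-reverseFrom s vs)) len)

  splitAt∈ : WalkVia s t vs → w ∈ s ∷ vs →
             ∃₂ λ ps qs → WalkVia s w ps × WalkVia w t qs × vs ≡ ps ++ qs
  splitAt∈ walk       (here refl) = [] , _ , [] , walk , refl
  splitAt∈ (e ∷ walk) (there w∈)  with ps , qs , w₁ , w₂ , eq ← splitAt∈ walk w∈ =
    _ ∷ ps , qs , e ∷ w₁ , w₂ , cong (_ ∷_) eq

  splitAt : ∀ m → WalkVia s t vs → ∃[ c ] WalkVia s c (take m vs) × WalkVia c t (drop m vs)
  splitAt zero    walk       = _ , [] , walk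
  splitAt (suc m) []         = _ , [] , []
  splitAt (suc m) (e ∷ walk) with c , w₁ , w₂ ← splitAt m walk = c , e ∷ w₁ , w₂

  Unique-suffix : WalkVia s c ps → Unique (s ∷ ps ++ qs) → Unique (c ∷ qs)
  Unique-suffix {ps = ps} walk u with _ , uqs , disjoint ← Unique-++⁻ (_ ∷ ps) u =
    Unique-∷⁺ (λ c∈qs → disjoint (end∈ walk , c∈qs)) uqs

  pathFrom∈ : Path w t ws → s ∈ w ∷ ws → ∃[ qs ] Path s t qs × length qs ≤ length ws × qs ⊆ ws
  pathFrom∈ (walk , u) s∈ with ps , qs , w₁ , w₂ , refl ← splitAt∈ walk s∈ =
    qs , (w₂ , Unique-suffix w₁ u) , length-++-≤ʳ qs {ps} , xs⊆ys++xs qs ps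

  shorten : WalkVia s t vs → ∃[ ws ] Path s t ws × length ws ≤ length vs × ws ⊆ vs
  shorten [] = [] , ([] , [] ∷ []) , z≤n , λ ()
  shorten {s = s} (_∷_ {w = w} e walk) with ws , (walk′ , u) , len , ws⊆ ← shorten walk
                                         with s ∈? w ∷ ws
  ... | no s∉ = w ∷ ws , (e ∷ walk′ , Unique-∷⁺ s∉ u) , s≤s len , ∷⁺ʳ w ws⊆
  ... | yes s∈ with qs , path , len′ , qs⊆ ← pathFrom∈ (walk′ , u) s∈ =
    qs , path , m≤n⇒m≤1+n (≤-trans len′ len) , there ∘ ws⊆ ∘ qs⊆

  pathWithin : DistLe G s t ℓ → ∃[ ps ] Path s t ps × length ps ≤ ℓ
  pathWithin dist with vs , walk , len ← fromDistLe dist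
                  with ps , path , len′ , _ ← shorten walk = ps , path , ≤-trans len′ len

  toChain : WalkVia s t vs → Chain G (s ∷ vs)
  toChain []                  = tt
  toChain (e ∷ [])            = e , tt
  toChain (e ∷ walk@(_ ∷ _)) = e , toChain walk

  closeCycle : Path s t vs → 2 ≤ length vs → Adj t s → HasCycle G
  closeCycle {s = s} {vs = vs} (walk , u) len e = s , vs , len , u , toChain (walk ++ʷ e ∷ [])

  module Forest (acyclic : ¬ HasCycle G) where

    -- Every edge c–a of a forest is a bridge: a walk from c to a that never
    -- returns to c must start along that edge.
    first-step : Adj c a → WalkVia c a (b ∷ vs) → c ∉ b ∷ vs → b ≡ a
    first-step {a = a} {b = b} ca (cb ∷ walk) c∉ with b ≟ a
    ... | yes b≡a = b≡a
    ... | no b≢a with ws , (walk′ , u) , _ , ws⊆ ← shorten walk =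
      ⊥-elim (acyclic (closeCycle (cb ∷ walk′ , Unique-∷⁺ (c∉ ∘ ∷⁺ʳ b ws⊆) u)
                                  (s≤s (nonempty walk′)) (Adj-sym ca)))
      where
        nonempty : WalkVia b a ws → 1 ≤ length ws
        nonempty []      = ⊥-elim (b≢a refl)
        nonempty (_ ∷ _) = s≤s z≤n

    branches-disjoint : Path c s (a ∷ ps) → Path c t (b ∷ qs) → a ≢ b → Disjoint (a ∷ ps) (b ∷ qs)
    branches-disjoint {c = c} {a = a} {b = b} (ca ∷ wa , ua) (cb ∷ wb , ub) a≢b (z∈a , z∈b)
      with ps′ , _ , wa₁ , _ , refl ← splitAt∈ wa z∈a
      with qs′ , _ , wb₁ , _ , refl ← splitAt∈ wb z∈b =
      a≢b (sym (first-step ca (cb ∷ wb₁ ++ʷ reverseʷ wa₁) c∉))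
      where
        c∉ : c ∉ b ∷ qs′ ++ reverseFrom a ps′
        c∉ c∈ with ∈-++⁻ (b ∷ qs′) c∈
        ... | inj₁ c∈b = Unique[x∷xs]⇒x∉xs ub (∈-++⁺ˡ c∈b)
        ... | inj₂ c∈a = Unique[x∷xs]⇒x∉xs ua (∈-++⁺ˡ (∈-reverseʷ wa₁ (there c∈a)))

    path-unique : Path c x ps → Path c x qs → ps ≡ qs
    path-unique ([] , _)     ([] , _)      = refl
    path-unique ([] , _)     (_ ∷ wb , u)  = ⊥-elim (Unique[x∷xs]⇒x∉xs u (end∈ wb))
    path-unique (_ ∷ wa , u) ([] , _)      = ⊥-elim (Unique[x∷xs]⇒x∉xs u (end∈ wa))
    path-unique (_∷_ {w = a} ca wa , ua@(_ ∷ ua′)) (_∷_ {w = b} cb wb , ub@(_ ∷ ub′)) with a ≟ b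
    ... | yes refl = cong (a ∷_) (path-unique (wa , ua′) (wb , ub′))
    ... | no a≢b   = ⊥-elim (branches-disjoint (ca ∷ wa , ua) (cb ∷ wb , ub) a≢b (end∈ wa , end∈ wb))

    misses-an-arm : Path c u ps → Path c v qs → Disjoint ps qs → Path c x ws →
                    Disjoint ps ws ⊎ Disjoint qs ws
    misses-an-arm {ps = []} _ _ _ _ = inj₁ λ { (() , _) }
    misses-an-arm {qs = []} _ _ _ _ = inj₂ λ { (() , _) }
    misses-an-arm {ws = []} _ _ _ _ = inj₁ λ { (_ , ()) }
    misses-an-arm {ps = p ∷ _} {qs = q ∷ _} {ws = w ∷ _} P Q disjoint W with p ≟ w
    ... | no p≢w   = inj₁ (branches-disjoint P W p≢w)
    ... | yes refl = inj₂ (branches-disjoint Q W (λ q≡p → disjoint (here refl , here (sym q≡p))))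

    module _ {d : ℕ} (close : ∀ u v → DistLe G u v d) where

      path-length-≤ : Path u v ps → length ps ≤ d
      path-length-≤ {u} {v} P with _ , Q , len ← pathWithin (close u v) =
        subst (_≤ d) (cong length (path-unique Q P)) len

      disjoint-branches-≤ : Path c u ps → Path c x qs → Disjoint ps qs → length ps + length qs ≤ d
      disjoint-branches-≤ {c = c} {u = u} {ps = ps} {qs = qs} P@(wp , _) (wq , uq@(_ ∷ uq′)) disjoint =
        subst (_≤ d) |rev++|
          (path-length-≤ (reverseʷ wp ++ʷ wq , ++⁺ (proj₂ (reversePath P)) uq′ apart))
        where
          apart : Disjoint (u ∷ reverseFrom c ps) qs
          apart (y∈ , y∈qs) with ∈-reverseʷ wp y∈
          ... | here refl  = Unique[x∷xs]⇒x∉xs uq y∈qs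
          ... | there y∈ps = disjoint (y∈ps , y∈qs)

          |rev++| : length (reverseFrom c ps ++ qs) ≡ length ps + length qs
          |rev++| = trans (length-++ (reverseFrom c ps)) (cong (_+ length qs) (length-reverseFrom c ps))

      longest-path-centre : Path u v ps → length ps ≡ d → ∃[ c ] ∀ x → DistLe G c x ⌈ d /2⌉
      longest-path-centre {u = u} {v = v} {ps = ps} (walk , uniq) |ps|≡d
        with c , w₁ , w₂ ← splitAt ⌊ d /2⌋ walk = c , eccentricity
        where
          front back : List (Fin n)
          front = take ⌊ d /2⌋ ps
          back  = drop ⌊ d /2⌋ ps

          halves : Unique (u ∷ front) × Unique back × Disjoint (u ∷ front) back
          halves = Unique-++⁻ (u ∷ front)
            (subst (λ vs → Unique (u ∷ vs)) (sym (take++drop≡id ⌊ d /2⌋ ps)) uniq)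

          L : Path c u (reverseFrom u front)
          L = reversePath (w₁ , proj₁ halves)

          R : Path c v back
          R = w₂ , Unique-∷⁺ (λ c∈ → proj₂ (proj₂ halves) (end∈ w₁ , c∈)) (proj₁ (proj₂ halves))

          L-R-disjoint : Disjoint (reverseFrom u front) back
          L-R-disjoint (y∈L , y∈R) = proj₂ (proj₂ halves) (∈-reverseʷ w₁ (there y∈L) , y∈R)

          |front| : length front ≡ ⌊ d /2⌋
          |front| = begin
            length (take ⌊ d /2⌋ ps) ≡⟨ length-take ⌊ d /2⌋ ps ⟩
            ⌊ d /2⌋ ⊓ length ps      ≡⟨ cong (⌊ d /2⌋ ⊓_) |ps|≡d ⟩
            ⌊ d /2⌋ ⊓ d              ≡⟨ m≤n⇒m⊓n≡m (⌊n/2⌋≤n d) ⟩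
            ⌊ d /2⌋                  ∎
            where open ≡-Reasoning

          |back| : length back ≡ ⌈ d /2⌉
          |back| = begin
            length (drop ⌊ d /2⌋ ps)      ≡⟨ length-drop ⌊ d /2⌋ ps ⟩
            length ps ∸ ⌊ d /2⌋           ≡⟨ cong (_∸ ⌊ d /2⌋) |ps|≡d ⟩
            d ∸ ⌊ d /2⌋                   ≡⟨ cong (_∸ ⌊ d /2⌋) (⌊n/2⌋+⌈n/2⌉≡n d) ⟨
            ⌊ d /2⌋ + ⌈ d /2⌉ ∸ ⌊ d /2⌋ ≡⟨ m+n∸m≡n ⌊ d /2⌋ ⌈ d /2⌉ ⟩
            ⌈ d /2⌉                       ∎
            where open ≡-Reasoning

          L-long : ⌊ d /2⌋ ≤ length (reverseFrom u front)
          L-long = ≤-reflexive (sym (trans (length-reverseFrom u front) |front|))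

          R-long : ⌊ d /2⌋ ≤ length back
          R-long = ≤-trans (⌊n/2⌋≤⌈n/2⌉ d) (≤-reflexive (sym |back|))

          eccentricity : ∀ x → DistLe G c x ⌈ d /2⌉
          eccentricity x with _ , Q , _ ← pathWithin (close c x) =
            toDistLe (proj₁ Q) (Sum.[ m+o≤n⇒o≤⌈n/2⌉ d L-long , m+o≤n⇒o≤⌈n/2⌉ d R-long ]
              (Sum.map (disjoint-branches-≤ L Q) (disjoint-branches-≤ R Q)
                       (misses-an-arm L R L-R-disjoint Q)))

  forest-radius : ∀ {d} → ¬ HasCycle G → IsDiameter G d → ∃[ c ] ∀ x → DistLe G c x ⌈ d /2⌉
  forest-radius acyclic (close , _ , _ , uv≤d , minimal) with _ , path , len ← pathWithin uv≤d =
    Forest.longest-path-centre acyclic close path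
      (≤-antisym len (minimal _ (toDistLe (proj₁ path) ≤-refl)))

module Guards {n : ℕ} (G : Graph n) (k : ℕ) where
  open Walks G using (DistLe-sym)

  zero-guards-lose : Fin n → ¬ EternalWins G k 0
  zero-guards-lose v (_ , (C , C∈S) , dominating , _) with () , _ ← dominating C C∈S v

  one-guard-loses : ∀ {u v} → ¬ DistLe G u v k → ¬ EternalWins G k 1
  one-guard-loses {u} {v} far (_ , (C , C∈S) , dominating , respond)
    with C′ , C′∈S , _ , (zero , C′₀≡u) ← respond C C∈S u
    with zero , reach ← dominating C′ C′∈S v =
    far (subst (λ y → DistLe G y v k) C′₀≡u reach)

  one-guard-wins : Fin n → (∀ u v → DistLe G u v k) → EternalWins G k 1
  one-guard-wins v₀ close =
    (λ _ → ⊤) , ((λ _ → v₀) , tt) ,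
    (λ C _ v → zero , close (C zero) v) ,
    (λ C _ v → (λ _ → v) , tt , (λ i → close (C i) v) , (zero , refl))

  guardsAt : Fin n → Fin n → Config G 2
  guardsAt a b zero    = a
  guardsAt a b (suc _) = b

  two-guards-win : (c : Fin n) → (∀ x → DistLe G c x k) → EternalWins G k 2
  two-guards-win c central = Centred , (guardsAt c c , zero , refl) , dominating , respond
    where
      Centred : Config G 2 → Set
      Centred C = ∃[ i ] C i ≡ c

      leave : ∀ {y} → y ≡ c → ∀ v → DistLe G y v k
      leave refl = central

      return : ∀ y → DistLe G y c k
      return y = DistLe-sym (central y)

      dominating : ∀ C → Centred C → Dominating G k C
      dominating C (i , Cᵢ≡c) v = i , leave Cᵢ≡c v

      respond : ∀ C → Centred C → ∀ v →
                Σ (Config G 2) λ C′ → Centred C′ × Move G k C C′ × Occupied G k C′ v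
      respond C (zero , C₀≡c) v = guardsAt v c , (suc zero , refl) , move , (zero , refl)
        where
          move : Move G k C (guardsAt v c)
          move zero       = leave C₀≡c v
          move (suc zero) = return (C (suc zero))
      respond C (suc zero , C₁≡c) v = guardsAt c v , (zero , refl) , move , (suc zero , refl)
        where
          move : Move G k C (guardsAt c v)
          move zero       = return (C zero)
          move (suc zero) = leave C₁≡c v

mainTheorem9 : (n : ℕ) (T : Graph n) → IsTree T → (k : ℕ) → 0 < k →
    (d : ℕ) → IsDiameter T d →
    ((k < d → d < 2 * k → EternalDomNum T k 2) × (d ≤ k → EternalDomNum T k 1))
-- The hypothesis 0 < k is not needed: in the first case it follows from k < d < 2 * k.
mainTheorem9 n T (nonempty , _ , acyclic) k _ d diameter@(close , _ , _ , _ , minimal) =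
  case-k<d<2k , case-d≤k
  where
    open Walks T using (DistLe-weaken; forest-radius)
    open Guards T k

    v₀ : Fin n
    v₀ = fromℕ< nonempty

    case-k<d<2k : k < d → d < 2 * k → EternalDomNum T k 2
    case-k<d<2k k<d d<2k with c , central ← forest-radius acyclic diameter =
      two-guards-win c (DistLe-weaken (n≤2m⇒⌈n/2⌉≤m (<⇒≤ d<2k)) ∘ central) , λ where
        0 _ → zero-guards-lose v₀
        1 _ → one-guard-loses (<⇒≱ k<d ∘ minimal k)
        (suc (suc _)) (s≤s (s≤s ()))

    case-d≤k : d ≤ k → EternalDomNum T k 1
    case-d≤k d≤k = one-guard-wins v₀ (λ x y → DistLe-weaken d≤k (close x y)) , λ where
      0 _ → zero-guards-lose v₀
      (suc _) (s≤s ())
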